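{- Let $m_1,\dots,m_j$ be positive integers. Then $b_2(K_{2m_1+1}+\dots+K_{2m_j+1})=(m_1+\dots+m_j)+1$.
   Context: $K_n$ is the complete graph on $n$ vertices and $+$ denotes disjoint union of graphs. An odd cover of a graph $G$ is a collection of complete bipartite graphs with disjoint parts $(X,Y)$, $X,Y\subseteq V(G)$, such that each edge of $G$ is covered (one endpoint in $X$, the other in $Y$) by an odd number of them and each nonedge by an even number; $b_2(G)$ is the minimum cardinality of an odd cover of $G$. -}

module Defs where

open import Data.Bool using (Bool; true; false; _∧_; _∨_; T)
open import Data.Nat using (ℕ; _+_; _*_; _%_; _≤_)
open import Data.Nat.ListAction using (sum)
open import Data.List using (List; length; filter; tabulate)
open import Data.Fin using (Fin)
open import Data.Product using (Σ; _×_; proj₁; ∃-syntax)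
open import Relation.Nullary using (¬_)
open import Relation.Nullary.Decidable using (T?)
open import Relation.Binary.PropositionalEquality using (_≡_; _≢_)

Graph : Set → Set₁
Graph V = V → V → Set

record Biclique (V : Set) : Set where
  field
    X        : V → Bool
    Y        : V → Bool
    disjoint : ∀ v → X v ∧ Y v ≡ false
open Biclique public

covers : {V : Set} → Biclique V → V → V → Bool
covers B u v = (X B u ∧ Y B v) ∨ (Y B u ∧ X B v)

coverCount : {V : Set} → List (Biclique V) → V → V → ℕ
coverCount C u v = length (filter (λ B → T? (covers B u v)) C)

IsOddCover : {V : Set} → Graph V → List (Biclique V) → Set
IsOddCover {V} G C =
  ∀ (u v : V) → u ≢ v →
    (G u v → coverCount C u v % 2 ≡ 1) × (¬ G u v → coverCount C u v % 2 ≡ 0)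

b₂≡ : {V : Set} → Graph V → ℕ → Set
b₂≡ G k =
  (∃[ C ] (IsOddCover G C × length C ≡ k)) ×
  (∀ C → IsOddCover G C → k ≤ length C)

-- K_{2 m_1 + 1} + ... + K_{2 m_j + 1}: vertices are pairs (i , a) with
-- a a vertex of the i-th complete graph; distinct vertices are adjacent
-- iff they lie in the same component.
KSumVertex : (j : ℕ) → (Fin j → ℕ) → Set
KSumVertex j m = Σ (Fin j) (λ i → Fin (2 * m i + 1))

KSum : (j : ℕ) (m : Fin j → ℕ) → Graph (KSumVertex j m)
KSum j m u v = (proj₁ u ≡ proj₁ v) × (u ≢ v)

sumFin : {j : ℕ} → (Fin j → ℕ) → ℕ
sumFin m = sum (tabulate m)

{-# OPTIONS --safe #-}
module Submission where

-- Over GF(2) an odd cover C of a graph G writes its adjacency matrix as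
-- A = Σ_B (x_B y_Bᵀ + y_B x_Bᵀ), x_B and y_B being the indicator vectors of the sides of B.
-- For a disjoint union of cliques, A + I is block diagonal with all-ones blocks, so A z = z
-- whenever z sums to zero on every clique; for cliques of sizes 2 m_t + 1 these z form a space
-- of dimension 2 Σ m_t.  If |C| ≤ Σ m_t, such a z ≠ 0 can be chosen orthogonal to all sides
-- except y_{B₁} (2 |C| − 1 conditions).  Then z = A z = x_{B₁} (y_{B₁} · z), and
-- y_{B₁} · z = (y_{B₁} · x_{B₁}) (y_{B₁} · z) = 0 as the sides of B₁ are disjoint, so z = 0.
--
-- For the matching cover, call the vertices of the s-th clique u_s (centre), v_{s,i} (left)
-- and w_{s,i} (right).  The biclique (all v, all w) together with, for every slot (t , i),
-- the biclique with Y = {v_{t,i}, w_{t,i}} and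
--   X = {u_t} ∪ {v_{t,i′} | i′ < i} ∪ {w_{t,i′} | i < i′} ∪ {w_{s,i′} | s ≢ t}
-- covers every pair inside a clique an odd number of times and every other pair an even number.

open import Defs
open import Data.Nat using (ℕ; _+_; _≤_)
open import Data.Fin using (Fin)

open import Algebra.Bundles using (CommutativeRing)
open import Data.Bool using (Bool; true; false; not; _∧_; _∨_; _xor_; if_then_else_)
open import Data.Bool.Properties as Boolₚ
  using (xor-∧-commutativeRing; xor-same; xor-identityʳ; xor-assoc; ∧-zeroʳ; ∧-identityʳ;
         ∧-comm; ∧-assoc; ∧-distribˡ-xor; ∧-distribʳ-xor; ∨-identityʳ; not-involutive; ¬-not)
open import Data.Fin as Fin using (zero; suc; toℕ; _↑ˡ_; _↑ʳ_; splitAt)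
open import Data.Fin.Properties using (suc-injective; toℕ-injective; splitAt⁻¹-↑ˡ; splitAt⁻¹-↑ʳ)
open import Data.List using (List; []; _∷_; _++_; length; map; tabulate)
open import Data.List.Properties using (length-map; length-++; length-tabulate; length-removeAt′)
open import Data.List.Relation.Unary.All as All using (All; []; _∷_)
open import Data.List.Relation.Unary.All.Properties as Allₚ using (¬Any⇒All¬)
open import Data.List.Relation.Unary.Any as Any using (Any; any?)
open import Data.Maybe using (Maybe; nothing; just; maybe′; is-just)
open import Data.Nat as ℕ using (zero; suc; _*_; _∸_; _%_; _<_; _<ᵇ_)
open import Data.Nat.Properties as ℕₚ using ()
open import Data.Nat.Tactic.RingSolver using (solve-∀)
open import Data.Product using (Σ; _×_; _,_; proj₁; proj₂; ∃-syntax)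
open import Data.Product.Properties using (≡-dec)
open import Data.Sum using (inj₁; inj₂)
open import Data.Vec.Functional using () renaming (_∷_ to _∷ᵛ_)
open import Function using (_∘_)
open import Relation.Binary.Definitions using (DecidableEquality)
open import Relation.Binary.PropositionalEquality
open import Relation.Nullary using (¬_; yes; no; contradiction; does)
open import Relation.Nullary.Decidable using (dec-true; dec-false)

open import Algebra.Properties.Semiring.Sum (CommutativeRing.semiring xor-∧-commutativeRing)
  using (sum; sum-cong-≗; sum-replicate-zero; ∑-distrib-+; *-distribˡ-sum)

private
  variable
    V : Set
    j N r : ℕ
    n : Fin j → ℕ

-- Finite sums over GF(2)

sum-zero : {f : Fin N → Bool} → (∀ i → f i ≡ false) → sum f ≡ false
sum-zero {N} f≡0 = trans (sum-cong-≗ f≡0) (sum-replicate-zero N)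

sum-single : {f : Fin N → Bool} (k : Fin N) → (∀ i → i ≢ k → f i ≡ false) → sum f ≡ f k
sum-single {f = f} zero off =
  trans (cong (f zero xor_) (sum-zero (λ i → off (suc i) λ ()))) (xor-identityʳ (f zero))
sum-single {f = f} (suc k) off =
  cong₂ _xor_ (off zero λ ()) (sum-single k (λ i i≢k → off (suc i) (i≢k ∘ suc-injective)))

sum-except : {f g : Fin N → Bool} (k : Fin N) → (∀ i → i ≢ k → f i ≡ g i) →
             sum f xor sum g ≡ f k xor g k
sum-except {f = f} {g} k agree = begin
  sum f xor sum g          ≡⟨ ∑-distrib-+ f g ⟨
  sum (λ i → f i xor g i)  ≡⟨ sum-single k cancel ⟩
  f k xor g k              ∎
  where
  open ≡-Reasoning
  cancel : ∀ i → i ≢ k → f i xor g i ≡ false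
  cancel i i≢k = trans (cong (_xor g i) (agree i i≢k)) (xor-same (g i))

-- Disjoint unions of blocks

Blocks : (j : ℕ) → (Fin j → ℕ) → Set
Blocks j n = Σ (Fin j) (λ t → Fin (n t))

Cliques : (j : ℕ) (n : Fin j → ℕ) → Graph (Blocks j n)
Cliques j n u v = proj₁ u ≡ proj₁ v × u ≢ v

_≟ᴮ_ : DecidableEquality (Blocks j n)
_≟ᴮ_ = ≡-dec Fin._≟_ Fin._≟_

∑ᴮ : (Blocks j n → Bool) → Bool
∑ᴮ f = sum λ t → sum λ a → f (t , a)

blockSum : Fin j → (Blocks j n → Bool) → Bool
blockSum s z = sum λ a → z (s , a)

∑ᴮ-cong : {f g : Blocks j n → Bool} → (∀ v → f v ≡ g v) → ∑ᴮ f ≡ ∑ᴮ g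
∑ᴮ-cong f≡g = sum-cong-≗ λ t → sum-cong-≗ λ a → f≡g (t , a)

∑ᴮ-xor : (f g : Blocks j n → Bool) → ∑ᴮ (λ v → f v xor g v) ≡ ∑ᴮ f xor ∑ᴮ g
∑ᴮ-xor f g = trans (sum-cong-≗ λ t → ∑-distrib-+ (λ a → f (t , a)) (λ a → g (t , a)))
                   (∑-distrib-+ (λ t → blockSum t f) (λ t → blockSum t g))

∑ᴮ-∧ˡ : ∀ x (f : Blocks j n → Bool) → ∑ᴮ (λ v → x ∧ f v) ≡ x ∧ ∑ᴮ f
∑ᴮ-∧ˡ x f = sym (trans (*-distribˡ-sum x (λ t → blockSum t f))
                        (sum-cong-≗ λ t → *-distribˡ-sum x λ a → f (t , a)))

∑ᴮ-zero : {f : Blocks j n → Bool} → (∀ v → f v ≡ false) → ∑ᴮ f ≡ false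
∑ᴮ-zero f≡0 = sum-zero λ t → sum-zero λ a → f≡0 (t , a)

∑ᴮ-block : {f : Blocks j n → Bool} (s : Fin j) →
           (∀ t a → t ≢ s → f (t , a) ≡ false) → ∑ᴮ f ≡ blockSum s f
∑ᴮ-block s off = sum-single s λ t t≢s → sum-zero λ a → off t a t≢s

∑ᴮ-single : {f : Blocks j n → Bool} (p : Blocks j n) →
            (∀ q → q ≢ p → f q ≡ false) → ∑ᴮ f ≡ f p
∑ᴮ-single (s , a) off =
  trans (∑ᴮ-block s λ t b t≢s → off (t , b) (t≢s ∘ cong proj₁))
        (sum-single a λ b b≢a → off (s , b) λ { refl → b≢a refl })

∑ᴮ-pick : (p : Blocks j n) (f : Blocks j n → Bool) →
          ∑ᴮ (λ q → f q ∧ does (p ≟ᴮ q)) ≡ f p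
∑ᴮ-pick p f = begin
  ∑ᴮ (λ q → f q ∧ does (p ≟ᴮ q)) ≡⟨ ∑ᴮ-single p off ⟩
  f p ∧ does (p ≟ᴮ p)            ≡⟨ cong (f p ∧_) (dec-true (p ≟ᴮ p) refl) ⟩
  f p ∧ true                     ≡⟨ ∧-identityʳ (f p) ⟩
  f p                            ∎
  where
  open ≡-Reasoning
  off : ∀ q → q ≢ p → f q ∧ does (p ≟ᴮ q) ≡ false
  off q q≢p = trans (cong (f q ∧_) (dec-false (p ≟ᴮ q) (q≢p ∘ sym))) (∧-zeroʳ (f q))

flatten : Blocks j n → Fin (sumFin n)
flatten {suc j} {n} (zero , a)  = a ↑ˡ sumFin (n ∘ suc)
flatten {suc j} {n} (suc t , a) = n zero ↑ʳ flatten (t , a)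

unflatten : Fin (sumFin n) → Blocks j n
unflatten {suc j} {n} i with splitAt (n zero) i
... | inj₁ a = zero , a
... | inj₂ i′ = let t , a = unflatten i′ in suc t , a

flatten-unflatten : (i : Fin (sumFin n)) → flatten {j} {n} (unflatten i) ≡ i
flatten-unflatten {suc j} {n} i with splitAt (n zero) i in eq
... | inj₁ a = splitAt⁻¹-↑ˡ eq
... | inj₂ i′ =
  trans (cong (n zero ↑ʳ_) (flatten-unflatten {n = n ∘ suc} i′)) (splitAt⁻¹-↑ʳ eq)

blockList : {A : Set} → (Blocks j n → A) → List A
blockList {zero}  f = []
blockList {suc j} f = tabulate (λ a → f (zero , a)) ++ blockList (λ (t , a) → f (suc t , a))

length-blockList : {A : Set} (f : Blocks j n → A) → length (blockList f) ≡ sumFin n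
length-blockList {zero}  f = refl
length-blockList {suc j} f =
  trans (length-++ (tabulate λ a → f (zero , a)))
        (cong₂ _+_ (length-tabulate λ a → f (zero , a)) (length-blockList λ (t , a) → f (suc t , a)))

-- Homogeneous linear systems over GF(2)

_⊕_ : {I : Set} → (I → Bool) → (I → Bool) → I → Bool
(c ⊕ d) i = c i xor d i

record IsLinear {I : Set} (f : (I → Bool) → Bool) : Set where
  field
    cong-≗   : ∀ {c d} → c ≗ d → f c ≡ f d
    additive : ∀ c d → f (c ⊕ d) ≡ f c xor f d
open IsLinear

HasNonzeroCommonZero : {I : Set} → List ((I → Bool) → Bool) → Set
HasNonzeroCommonZero {I} fs = ∃[ c ] (∃[ i ] c i ≡ true) × All (λ f → f c ≡ false) fs

e₀ : Fin (suc N) → Bool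
e₀ = true ∷ᵛ λ _ → false

-- If h e₀ ≡ true then h (x ∷ c) ≡ x xor h (false ∷ c), so x := h (false ∷ c) solves h = 0.
substitute : ((Fin (suc N) → Bool) → Bool) → (Fin N → Bool) → Fin (suc N) → Bool
substitute h c = h (false ∷ᵛ c) ∷ᵛ c

substitute-vanishes : {h : (Fin (suc N) → Bool) → Bool} → IsLinear h → h e₀ ≡ true →
                      ∀ c → h (substitute h c) ≡ false
substitute-vanishes {h = h} lin h[e₀] c with h (false ∷ᵛ c) in eq
... | false = eq
... | true = begin
  h (true ∷ᵛ c)               ≡⟨ cong-≗ lin (λ { zero → refl ; (suc i) → refl }) ⟩
  h (e₀ ⊕ (false ∷ᵛ c))       ≡⟨ additive lin e₀ (false ∷ᵛ c) ⟩
  h e₀ xor h (false ∷ᵛ c)     ≡⟨ cong₂ _xor_ h[e₀] eq ⟩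
  false                      ∎
  where open ≡-Reasoning

substitute-linear : {h g : (Fin (suc N) → Bool) → Bool} → IsLinear h → IsLinear g →
                    IsLinear (g ∘ substitute h)
cong-≗ (substitute-linear lin-h lin-g) c≗d = cong-≗ lin-g λ
  { zero → cong-≗ lin-h λ { zero → refl ; (suc i) → c≗d i }
  ; (suc i) → c≗d i }
additive (substitute-linear {h = h} lin-h lin-g) c d = trans (cong-≗ lin-g pointwise) (additive lin-g _ _)
  where
  pointwise : substitute h (c ⊕ d) ≗ substitute h c ⊕ substitute h d
  pointwise zero = trans (cong-≗ lin-h λ { zero → refl ; (suc i) → refl }) (additive lin-h _ _)
  pointwise (suc i) = refl

underdetermined⇒nonzero-solution : (fs : List ((Fin N → Bool) → Bool)) → All IsLinear fs →
                                   length fs < N → HasNonzeroCommonZero fs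
underdetermined⇒nonzero-solution {suc N} fs lin lt with any? (λ f → f e₀ Boolₚ.≟ true) fs
... | no no-pivot = e₀ , (zero , refl) , All.map ¬-not (¬Any⇒All¬ fs no-pivot)
... | yes pivot =
  let c , (i , c[i]) , rest[c] = underdetermined⇒nonzero-solution reduced lin-reduced fewer
  in  substitute h c , (suc i , c[i])
    , Allₚ.─⁻ pivot (substitute-vanishes lin-h h[e₀] c) (Allₚ.map⁻ rest[c])
  where
  h = Any.lookup pivot
  lin-h = proj₁ (All.lookupAny lin pivot)
  h[e₀] = proj₂ (All.lookupAny lin pivot)
  rest = fs Any.─ pivot
  reduced = map (_∘ substitute h) rest
  lin-reduced = Allₚ.map⁺ (All.map (substitute-linear lin-h) (Allₚ.─⁺ pivot lin))
  fewer : length reduced < N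
  fewer rewrite length-map (_∘ substitute h) rest =
    ℕₚ.≤-pred (subst (_< suc N) (length-removeAt′ fs (Any.index pivot)) lt)

underdetermined⇒nonzero-solution-via : {V : Set} (index : V → Fin N) (point : Fin N → V) →
  (∀ i → index (point i) ≡ i) → (fs : List ((V → Bool) → Bool)) → All IsLinear fs →
  length fs < N → HasNonzeroCommonZero fs
underdetermined⇒nonzero-solution-via {N} index point section fs lin lt =
  let c , (i , c[i]) , zeros = underdetermined⇒nonzero-solution (map pullback fs)
                                 (Allₚ.map⁺ (All.map pullback-linear lin))
                                 (subst (_< N) (sym (length-map pullback fs)) lt)
  in c ∘ index , (point i , trans (cong c (section i)) c[i]) , Allₚ.map⁻ zeros
  where
  pullback : ((_ → Bool) → Bool) → (Fin N → Bool) → Bool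
  pullback f c = f (c ∘ index)
  pullback-linear : ∀ {f} → IsLinear f → IsLinear (pullback f)
  cong-≗ (pullback-linear lin-f) c≗d = cong-≗ lin-f (c≗d ∘ index)
  additive (pullback-linear lin-f) c d = additive lin-f (c ∘ index) (d ∘ index)

-- Parity of covering numbers

parity : ℕ → Bool
parity zero    = false
parity (suc n) = not (parity n)

parity-% : ∀ n → n % 2 ≡ (if parity n then 1 else 0)
parity-% zero          = refl
parity-% (suc zero)    = refl
parity-% (suc (suc n)) rewrite not-involutive (parity n) = parity-% n

%2≡1⇒parity : ∀ n → n % 2 ≡ 1 → parity n ≡ true
%2≡1⇒parity n odd with parity n | parity-% n
... | true  | _    = refl
... | false | even = contradiction (trans (sym even) odd) λ ()

%2≡0⇒parity : ∀ n → n % 2 ≡ 0 → parity n ≡ false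
%2≡0⇒parity n even with parity n | parity-% n
... | false | _   = refl
... | true  | odd = contradiction (trans (sym odd) even) λ ()

coverParity : List (Biclique V) → V → V → Bool
coverParity C u v = parity (coverCount C u v)

coverParity-∷ : ∀ B C (u v : V) → coverParity (B ∷ C) u v ≡ covers B u v xor coverParity C u v
coverParity-∷ B C u v with covers B u v
... | true  = refl
... | false = refl

coverParity-++ : ∀ C D (u v : V) →
                 coverParity (C ++ D) u v ≡ coverParity C u v xor coverParity D u v
coverParity-++ []      D u v = refl
coverParity-++ (B ∷ C) D u v = begin
  coverParity (B ∷ C ++ D) u v
    ≡⟨ coverParity-∷ B (C ++ D) u v ⟩
  covers B u v xor coverParity (C ++ D) u v
    ≡⟨ cong (covers B u v xor_) (coverParity-++ C D u v) ⟩
  covers B u v xor (coverParity C u v xor coverParity D u v)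
    ≡⟨ xor-assoc (covers B u v) _ _ ⟨
  (covers B u v xor coverParity C u v) xor coverParity D u v
    ≡⟨ cong (_xor coverParity D u v) (coverParity-∷ B C u v) ⟨
  coverParity (B ∷ C) u v xor coverParity D u v
    ∎
  where open ≡-Reasoning

coverParity-tabulate : (F : Fin N → Biclique V) (u v : V) →
                       coverParity (tabulate F) u v ≡ sum (λ i → covers (F i) u v)
coverParity-tabulate {zero}  F u v = refl
coverParity-tabulate {suc N} F u v =
  trans (coverParity-∷ (F zero) _ u v)
        (cong (covers (F zero) u v xor_) (coverParity-tabulate (F ∘ suc) u v))

coverParity-blockList : (F : Blocks j n → Biclique V) (u v : V) →
                        coverParity (blockList F) u v ≡ ∑ᴮ (λ p → covers (F p) u v)
coverParity-blockList {zero}  F u v = refl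
coverParity-blockList {suc j} F u v =
  trans (coverParity-++ (tabulate λ a → F (zero , a)) _ u v)
        (cong₂ _xor_ (coverParity-tabulate (λ a → F (zero , a)) u v)
                     (coverParity-blockList (λ (t , a) → F (suc t , a)) u v))

covers-xor : (B : Biclique V) (u v : V) → covers B u v ≡ (X B u ∧ Y B v) xor (Y B u ∧ X B v)
covers-xor B u v with X B u | Y B u | disjoint B u
... | false | false | _ = refl
... | false | true  | _ = refl
... | true  | false | _ = trans (∨-identityʳ (Y B v)) (sym (xor-identityʳ (Y B v)))

covers-self : (B : Biclique V) (u : V) → covers B u u ≡ false
covers-self B u with X B u | Y B u | disjoint B u
... | false | false | _ = refl
... | false | true  | _ = refl
... | true  | false | _ = refl

coverParity-self : (C : List (Biclique V)) (u : V) → coverParity C u u ≡ false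
coverParity-self []      u = refl
coverParity-self (B ∷ C) u =
  trans (coverParity-∷ B C u u) (cong₂ _xor_ (covers-self B u) (coverParity-self C u))

module _ {G : Graph V} {C : List (Biclique V)} (odd : IsOddCover G C) {u v : V} (u≢v : u ≢ v) where

  oddCover-edge : G u v → coverParity C u v ≡ true
  oddCover-edge e = %2≡1⇒parity (coverCount C u v) (proj₁ (odd u v u≢v) e)

  oddCover-nonedge : ¬ G u v → coverParity C u v ≡ false
  oddCover-nonedge ¬e = %2≡0⇒parity (coverCount C u v) (proj₂ (odd u v u≢v) ¬e)

parity⇒IsOddCover : {G : Graph V} {C : List (Biclique V)} →
  (∀ u v → u ≢ v → (G u v → coverParity C u v ≡ true) ×
                    (¬ G u v → coverParity C u v ≡ false)) →
  IsOddCover G C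
parity⇒IsOddCover {C = C} par u v u≢v =
  count ∘ proj₁ (par u v u≢v) , count ∘ proj₂ (par u v u≢v)
  where
  count : ∀ {b} → coverParity C u v ≡ b → coverCount C u v % 2 ≡ (if b then 1 else 0)
  count eq = trans (parity-% (coverCount C u v)) (cong (λ b → if b then 1 else 0) eq)

-- Lower bound for disjoint unions of cliques

_·_ : (Blocks j n → Bool) → (Blocks j n → Bool) → Bool
x · z = ∑ᴮ λ v → x v ∧ z v

·-linear : (x : Blocks j n → Bool) → IsLinear (x ·_)
cong-≗   (·-linear x) c≗d = ∑ᴮ-cong λ v → cong (x v ∧_) (c≗d v)
additive (·-linear x) c d =
  trans (∑ᴮ-cong λ v → ∧-distribˡ-xor (x v) (c v) (d v))
        (∑ᴮ-xor (λ v → x v ∧ c v) (λ v → x v ∧ d v))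

blockSum-linear : (s : Fin j) → IsLinear (blockSum {n = n} s)
cong-≗   (blockSum-linear s) c≗d = sum-cong-≗ λ a → c≗d (s , a)
additive (blockSum-linear s) c d = ∑-distrib-+ (λ a → c (s , a)) (λ a → d (s , a))

∑-covers : ∀ B (z : Blocks j n → Bool) u →
  ∑ᴮ (λ v → covers B u v ∧ z v) ≡ (X B u ∧ (Y B · z)) xor (Y B u ∧ (X B · z))
∑-covers B z u = begin
  ∑ᴮ (λ v → covers B u v ∧ z v)
    ≡⟨ ∑ᴮ-cong expand ⟩
  ∑ᴮ (λ v → (X B u ∧ (Y B v ∧ z v)) xor (Y B u ∧ (X B v ∧ z v)))
    ≡⟨ ∑ᴮ-xor (λ v → X B u ∧ (Y B v ∧ z v)) (λ v → Y B u ∧ (X B v ∧ z v)) ⟩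
  ∑ᴮ (λ v → X B u ∧ (Y B v ∧ z v)) xor ∑ᴮ (λ v → Y B u ∧ (X B v ∧ z v))
    ≡⟨ cong₂ _xor_ (∑ᴮ-∧ˡ (X B u) λ v → Y B v ∧ z v)
                   (∑ᴮ-∧ˡ (Y B u) λ v → X B v ∧ z v) ⟩
  (X B u ∧ (Y B · z)) xor (Y B u ∧ (X B · z))
    ∎
  where
  open ≡-Reasoning
  expand : ∀ v → covers B u v ∧ z v ≡ (X B u ∧ (Y B v ∧ z v)) xor (Y B u ∧ (X B v ∧ z v))
  expand v = begin
    covers B u v ∧ z v
      ≡⟨ cong (_∧ z v) (covers-xor B u v) ⟩
    ((X B u ∧ Y B v) xor (Y B u ∧ X B v)) ∧ z v
      ≡⟨ ∧-distribʳ-xor (z v) (X B u ∧ Y B v) (Y B u ∧ X B v) ⟩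
    ((X B u ∧ Y B v) ∧ z v) xor ((Y B u ∧ X B v) ∧ z v)
      ≡⟨ cong₂ _xor_ (∧-assoc (X B u) (Y B v) (z v)) (∧-assoc (Y B u) (X B v) (z v)) ⟩
    (X B u ∧ (Y B v ∧ z v)) xor (Y B u ∧ (X B v ∧ z v))
      ∎

coverAction : List (Biclique (Blocks j n)) → (Blocks j n → Bool) → Blocks j n → Bool
coverAction C z u = ∑ᴮ λ v → coverParity C u v ∧ z v

coverAction-∷ : ∀ B C (z : Blocks j n → Bool) u →
  coverAction (B ∷ C) z u ≡ ((X B u ∧ (Y B · z)) xor (Y B u ∧ (X B · z))) xor coverAction C z u
coverAction-∷ B C z u = begin
  ∑ᴮ (λ v → coverParity (B ∷ C) u v ∧ z v)
    ≡⟨ ∑ᴮ-cong (λ v → cong (_∧ z v) (coverParity-∷ B C u v)) ⟩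
  ∑ᴮ (λ v → (covers B u v xor coverParity C u v) ∧ z v)
    ≡⟨ ∑ᴮ-cong (λ v → ∧-distribʳ-xor (z v) (covers B u v) (coverParity C u v)) ⟩
  ∑ᴮ (λ v → (covers B u v ∧ z v) xor (coverParity C u v ∧ z v))
    ≡⟨ ∑ᴮ-xor (λ v → covers B u v ∧ z v) (λ v → coverParity C u v ∧ z v) ⟩
  ∑ᴮ (λ v → covers B u v ∧ z v) xor coverAction C z u
    ≡⟨ cong (_xor coverAction C z u) (∑-covers B z u) ⟩
  ((X B u ∧ (Y B · z)) xor (Y B u ∧ (X B · z))) xor coverAction C z u
    ∎
  where open ≡-Reasoning

sides : List (Biclique V) → List (V → Bool)
sides []      = []
sides (B ∷ C) = X B ∷ Y B ∷ sides C

constraints : List (Biclique V) → List (V → Bool)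
constraints []      = []
constraints (B ∷ C) = X B ∷ sides C

length-constraints : (C : List (Biclique V)) → length (constraints C) ≡ 2 * length C ∸ 1
length-constraints []      = refl
length-constraints (B ∷ C) = trans (cong suc (length-sides C)) (sym (ℕₚ.+-suc _ _))
  where
  length-sides : (C : List (Biclique V)) → length (sides C) ≡ 2 * length C
  length-sides []      = refl
  length-sides (B ∷ C) = cong suc (trans (cong suc (length-sides C)) (sym (ℕₚ.+-suc _ _)))

coverAction-orthogonal : {z : Blocks j n → Bool} (C : List (Biclique (Blocks j n))) →
  All (λ x → x · z ≡ false) (sides C) → ∀ u → coverAction C z u ≡ false
coverAction-orthogonal {z = z} [] [] u = ∑ᴮ-zero {f = λ v → false ∧ z v} λ v → refl
coverAction-orthogonal {z = z} (B ∷ C) (x·z ∷ y·z ∷ rest) u = begin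
  coverAction (B ∷ C) z u                                          ≡⟨ coverAction-∷ B C z u ⟩
  ((X B u ∧ (Y B · z)) xor (Y B u ∧ (X B · z))) xor coverAction C z u
    ≡⟨ cong₂ _xor_ (cong₂ _xor_ (cong (X B u ∧_) y·z) (cong (Y B u ∧_) x·z))
                   (coverAction-orthogonal C rest u) ⟩
  ((X B u ∧ false) xor (Y B u ∧ false)) xor false
    ≡⟨ cong₂ (λ a b → (a xor b) xor false) (∧-zeroʳ (X B u)) (∧-zeroʳ (Y B u)) ⟩
  false                                                            ∎
  where open ≡-Reasoning

fixedPoint-orthogonal⇒zero : {z : Blocks j n → Bool} (C : List (Biclique (Blocks j n))) →
  (∀ u → coverAction C z u ≡ z u) → All (λ x → x · z ≡ false) (constraints C) →
  ∀ u → z u ≡ false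
fixedPoint-orthogonal⇒zero {z = z} [] fixed _ u =
  trans (sym (fixed u)) (coverAction-orthogonal {z = z} [] [] u)
fixedPoint-orthogonal⇒zero {z = z} (B ∷ C) fixed (x·z ∷ rest) u =
  trans (z≡X∧d u) (trans (cong (X B u ∧_) d≡0) (∧-zeroʳ (X B u)))
  where
  open ≡-Reasoning
  d = Y B · z
  z≡X∧d : ∀ u → z u ≡ X B u ∧ d
  z≡X∧d u = begin
    z u                                                  ≡⟨ fixed u ⟨
    coverAction (B ∷ C) z u                              ≡⟨ coverAction-∷ B C z u ⟩
    ((X B u ∧ d) xor (Y B u ∧ (X B · z))) xor coverAction C z u
      ≡⟨ cong₂ (λ a b → ((X B u ∧ d) xor (Y B u ∧ a)) xor b) x·z (coverAction-orthogonal C rest u) ⟩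
    ((X B u ∧ d) xor (Y B u ∧ false)) xor false
      ≡⟨ cong (λ b → ((X B u ∧ d) xor b) xor false) (∧-zeroʳ (Y B u)) ⟩
    ((X B u ∧ d) xor false) xor false
      ≡⟨ trans (xor-identityʳ _) (xor-identityʳ _) ⟩
    X B u ∧ d
      ∎
  d≡0 : d ≡ false
  d≡0 = begin
    ∑ᴮ (λ v → Y B v ∧ z v)          ≡⟨ ∑ᴮ-cong (λ v → cong (Y B v ∧_) (z≡X∧d v)) ⟩
    ∑ᴮ (λ v → Y B v ∧ (X B v ∧ d))  ≡⟨ ∑ᴮ-zero disjoint-sides ⟩
    false                           ∎
    where
    disjoint-sides : ∀ v → Y B v ∧ (X B v ∧ d) ≡ false
    disjoint-sides v = trans (sym (∧-assoc (Y B v) (X B v) d))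
                             (cong (_∧ d) (trans (∧-comm (Y B v) (X B v)) (disjoint B v)))

cliques-cover-fixes : {n : Fin j → ℕ} {C : List (Biclique (Blocks j n))} {z : Blocks j n → Bool} →
  IsOddCover (Cliques j n) C → (∀ s → blockSum s z ≡ false) → ∀ u → coverAction C z u ≡ z u
cliques-cover-fixes {j} {n} {C} {z} odd zero-sums (s , a) = begin
  coverAction C z (s , a)           ≡⟨ ∑ᴮ-block s off-block ⟩
  blockSum s g                      ≡⟨ xor-identityʳ (blockSum s g) ⟨
  blockSum s g xor false            ≡⟨ cong (blockSum s g xor_) (zero-sums s) ⟨
  blockSum s g xor blockSum s z     ≡⟨ sum-except a on-block ⟩
  g (s , a) xor z (s , a)
    ≡⟨ cong (λ b → (b ∧ z (s , a)) xor z (s , a)) (coverParity-self C (s , a)) ⟩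
  z (s , a)                         ∎
  where
  open ≡-Reasoning
  g : Blocks j n → Bool
  g v = coverParity C (s , a) v ∧ z v
  off-block : ∀ t b → t ≢ s → g (t , b) ≡ false
  off-block t b t≢s = cong (_∧ z (t , b))
    (oddCover-nonedge {G = Cliques j n} {C = C} odd (t≢s ∘ sym ∘ cong proj₁)
                                                    (t≢s ∘ sym ∘ proj₁))
  on-block : ∀ b → b ≢ a → g (s , b) ≡ z (s , b)
  on-block b b≢a = cong (_∧ z (s , b)) (oddCover-edge {G = Cliques j n} {C = C} odd a≢b (refl , a≢b))
    where
    a≢b : (s , a) ≢ (s , b)
    a≢b refl = b≢a refl

cliques-oddCover-bound : (n : Fin j → ℕ) (C : List (Biclique (Blocks j n))) →
  IsOddCover (Cliques j n) C → sumFin n ≤ j + (2 * length C ∸ 1)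
cliques-oddCover-bound {j} n C odd = ℕₚ.≮⇒≥ λ few-constraints →
  let z , (u , z[u]) , zeros =
        underdetermined⇒nonzero-solution-via (flatten {n = n}) unflatten (flatten-unflatten {n = n})
          forms linear (subst (_< sumFin n) (sym length-forms) few-constraints)
      blocks-zero , constraints-zero = Allₚ.++⁻ blockSums zeros
      z≡0 = fixedPoint-orthogonal⇒zero C (cliques-cover-fixes {C = C} odd (Allₚ.tabulate⁻ blocks-zero))
                                         (Allₚ.map⁻ constraints-zero)
  in contradiction (trans (sym z[u]) (z≡0 u)) λ ()
  where
  blockSums : List ((Blocks j n → Bool) → Bool)
  blockSums = tabulate blockSum
  forms : List ((Blocks j n → Bool) → Bool)
  forms = blockSums ++ map _·_ (constraints C)
  linear : All IsLinear forms
  linear = Allₚ.++⁺ (Allₚ.tabulate⁺ blockSum-linear)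
                    (Allₚ.map⁺ (All.universal ·-linear (constraints C)))
  length-forms : length forms ≡ j + (2 * length C ∸ 1)
  length-forms = trans (length-++ blockSums)
                       (cong₂ _+_ (length-tabulate blockSum)
                                  (trans (length-map _·_ (constraints C)) (length-constraints C)))

-- An optimal cover

data Kind (r : ℕ) : Set where
  centre : Kind r
  left right : Fin r → Kind r

kind : ∀ r → Fin (2 * r + 1) → Kind r
kind r a with splitAt (2 * r) a
... | inj₂ _ = centre
... | inj₁ b with splitAt r b
...   | inj₁ i = left i
...   | inj₂ b′ with splitAt r {0} b′
...     | inj₁ i = right i

fromKind : Kind r → Fin (2 * r + 1)
fromKind {r} centre    = 2 * r ↑ʳ zero
fromKind {r} (left i)  = (i ↑ˡ (r + 0)) ↑ˡ 1
fromKind {r} (right i) = (r ↑ʳ (i ↑ˡ 0)) ↑ˡ 1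

fromKind-kind : ∀ r a → fromKind (kind r a) ≡ a
fromKind-kind r a with splitAt (2 * r) a in eq
... | inj₂ zero = splitAt⁻¹-↑ʳ eq
... | inj₁ b with splitAt r b in eq′
...   | inj₁ i = trans (cong (_↑ˡ 1) (splitAt⁻¹-↑ˡ eq′)) (splitAt⁻¹-↑ˡ eq)
...   | inj₂ b′ with splitAt r {0} b′ in eq″
...     | inj₁ i = trans (cong (λ b → (r ↑ʳ b) ↑ˡ 1) (splitAt⁻¹-↑ˡ eq″))
                         (trans (cong (_↑ˡ 1) (splitAt⁻¹-↑ʳ eq′)) (splitAt⁻¹-↑ˡ eq))

kind-injective : ∀ r {a a′} → kind r a ≡ kind r a′ → a ≡ a′
kind-injective r {a} {a′} eq =
  trans (sym (fromKind-kind r a)) (trans (cong fromKind eq) (fromKind-kind r a′))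

<ᵇ-irrefl : ∀ m → (m <ᵇ m) ≡ false
<ᵇ-irrefl zero    = refl
<ᵇ-irrefl (suc m) = <ᵇ-irrefl m

<ᵇ-xor-flip : ∀ m m′ → m ≢ m′ → (m <ᵇ m′) xor (m′ <ᵇ m) ≡ true
<ᵇ-xor-flip zero    zero     m≢m′ = contradiction refl m≢m′
<ᵇ-xor-flip zero    (suc m′) _    = refl
<ᵇ-xor-flip (suc m) zero     _    = refl
<ᵇ-xor-flip (suc m) (suc m′) m≢m′ = <ᵇ-xor-flip m m′ (m≢m′ ∘ cong suc)

isLeft isRight : Kind r → Bool
isLeft (left _)   = true
isLeft _          = false
isRight (right _) = true
isRight _         = false

slot : Kind r → Maybe (Fin r)
slot centre    = nothing
slot (left i)  = just i
slot (right i) = just i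

localX : ℕ → Kind r → Bool
localX i centre     = true
localX i (left i′)  = toℕ i′ <ᵇ i
localX i (right i′) = i <ᵇ toℕ i′

localX-own-slot : ∀ (k : Kind r) {i} → slot k ≡ just i → localX (toℕ i) k ≡ false
localX-own-slot (left i)  refl = <ᵇ-irrefl (toℕ i)
localX-own-slot (right i) refl = <ᵇ-irrefl (toℕ i)

localXAtSlot : Kind r → Kind r → Bool
localXAtSlot k k′ = maybe′ (λ i → localX (toℕ i) k) false (slot k′)

leftRightCovers : ∀ {r r′} → Kind r → Kind r′ → Bool
leftRightCovers k k′ = (isLeft k ∧ isRight k′) ∨ (isRight k ∧ isLeft k′)

same-block-parity : (k k′ : Kind r) → k ≢ k′ →
  leftRightCovers k k′ xor (localXAtSlot k k′ xor localXAtSlot k′ k) ≡ true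
same-block-parity centre    centre     k≢k′ = contradiction refl k≢k′
same-block-parity centre    (left _)   _    = refl
same-block-parity centre    (right _)  _    = refl
same-block-parity (left _)  centre     _    = refl
same-block-parity (right _) centre     _    = refl
same-block-parity (left i)  (left i′)  k≢k′ =
  <ᵇ-xor-flip (toℕ i) (toℕ i′) (k≢k′ ∘ cong left ∘ toℕ-injective)
same-block-parity (right i) (right i′) k≢k′ =
  <ᵇ-xor-flip (toℕ i′) (toℕ i) (k≢k′ ∘ cong right ∘ sym ∘ toℕ-injective)
same-block-parity (left i)  (right i′) _    = cong not (xor-same (toℕ i <ᵇ toℕ i′))
same-block-parity (right i) (left i′)  _    = cong not (xor-same (toℕ i′ <ᵇ toℕ i))

cross-block-parity : ∀ {r r′} (k : Kind r) (k′ : Kind r′) →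
  leftRightCovers k k′ xor ((is-just (slot k′) ∧ isRight k) xor (is-just (slot k) ∧ isRight k′))
    ≡ false
cross-block-parity centre    centre    = refl
cross-block-parity centre    (left _)  = refl
cross-block-parity centre    (right _) = refl
cross-block-parity (left _)  centre    = refl
cross-block-parity (left _)  (left _)  = refl
cross-block-parity (left _)  (right _) = refl
cross-block-parity (right _) centre    = refl
cross-block-parity (right _) (left _)  = refl
cross-block-parity (right _) (right _) = refl

module Construction {j : ℕ} (m : Fin j → ℕ) where

  Vertex : Set
  Vertex = KSumVertex j m

  kindOf : (v : Vertex) → Kind (m (proj₁ v))
  kindOf (s , a) = kind (m s) a

  leftRight : Biclique Vertex
  X leftRight v = isLeft (kindOf v)
  Y leftRight v = isRight (kindOf v)
  disjoint leftRight v with kindOf v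
  ... | centre  = refl
  ... | left _  = refl
  ... | right _ = refl

  inXᵏ inYᵏ : Blocks j m → (s : Fin j) → Kind (m s) → Bool
  inXᵏ (t , i) s k = if does (s Fin.≟ t) then localX (toℕ i) k else isRight k
  inYᵏ p       s k = maybe′ (λ i → does ((s , i) ≟ᴮ p)) false (slot k)

  inXᵏ-same : ∀ s i (k : Kind (m s)) → inXᵏ (s , i) s k ≡ localX (toℕ i) k
  inXᵏ-same s i k rewrite dec-true (s Fin.≟ s) refl = refl

  inXᵏ-other : ∀ {s t} i (k : Kind (m s)) → s ≢ t → inXᵏ (t , i) s k ≡ isRight k
  inXᵏ-other {s} {t} i k s≢t rewrite dec-false (s Fin.≟ t) s≢t = refl

  inXᵏ-inYᵏ-disjoint : ∀ p s (k : Kind (m s)) → inXᵏ p s k ∧ inYᵏ p s k ≡ false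
  inXᵏ-inYᵏ-disjoint p s k with slot k in own
  ... | nothing = ∧-zeroʳ (inXᵏ p s k)
  ... | just i with (s , i) ≟ᴮ p
  ...   | no _     = ∧-zeroʳ (inXᵏ p s k)
  ...   | yes refl = cong (_∧ true) (trans (inXᵏ-same s i k) (localX-own-slot k own))

  inX inY : Blocks j m → Vertex → Bool
  inX p (s , a) = inXᵏ p s (kind (m s) a)
  inY p (s , a) = inYᵏ p s (kind (m s) a)

  biclique : Blocks j m → Biclique Vertex
  X (biclique p) = inX p
  Y (biclique p) = inY p
  disjoint (biclique p) (s , a) = inXᵏ-inYᵏ-disjoint p s (kind (m s) a)

  cover : List (Biclique Vertex)
  cover = leftRight ∷ blockList biclique

  length-cover : length cover ≡ sumFin m + 1
  length-cover = trans (cong suc (length-blockList biclique)) (ℕₚ.+-comm 1 (sumFin m))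

  inXAtSlot : Vertex → Vertex → Bool
  inXAtSlot x (s , a) = maybe′ (λ i → inX (s , i) x) false (slot (kindOf (s , a)))

  ∑-inX-inY : ∀ x y → ∑ᴮ (λ p → inX p x ∧ inY p y) ≡ inXAtSlot x y
  ∑-inX-inY x (s , a) with slot (kindOf (s , a))
  ... | nothing = ∑ᴮ-zero λ p → ∧-zeroʳ (inX p x)
  ... | just i  = ∑ᴮ-pick (s , i) (λ p → inX p x)

  coverParity-cover : ∀ x y →
    coverParity cover x y ≡ covers leftRight x y xor (inXAtSlot x y xor inXAtSlot y x)
  coverParity-cover x y = begin
    coverParity cover x y
      ≡⟨ coverParity-∷ leftRight (blockList biclique) x y ⟩
    covers leftRight x y xor coverParity (blockList biclique) x y
      ≡⟨ cong (covers leftRight x y xor_) (begin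
    coverParity (blockList biclique) x y
      ≡⟨ coverParity-blockList biclique x y ⟩
    ∑ᴮ (λ p → covers (biclique p) x y)
      ≡⟨ ∑ᴮ-cong expand ⟩
    ∑ᴮ (λ p → (inX p x ∧ inY p y) xor (inX p y ∧ inY p x))
      ≡⟨ ∑ᴮ-xor (λ p → inX p x ∧ inY p y) (λ p → inX p y ∧ inY p x) ⟩
    ∑ᴮ (λ p → inX p x ∧ inY p y) xor ∑ᴮ (λ p → inX p y ∧ inY p x)
      ≡⟨ cong₂ _xor_ (∑-inX-inY x y) (∑-inX-inY y x) ⟩
    inXAtSlot x y xor inXAtSlot y x
      ∎) ⟩
    covers leftRight x y xor (inXAtSlot x y xor inXAtSlot y x)
      ∎
    where
    open ≡-Reasoning
    expand : ∀ p → covers (biclique p) x y ≡ (inX p x ∧ inY p y) xor (inX p y ∧ inY p x)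
    expand p = trans (covers-xor (biclique p) x y)
                     (cong ((inX p x ∧ inY p y) xor_) (∧-comm (inY p x) (inX p y)))

  inXAtSlot-same : ∀ s a a′ →
    inXAtSlot (s , a) (s , a′) ≡ localXAtSlot (kindOf (s , a)) (kindOf (s , a′))
  inXAtSlot-same s a a′ with slot (kindOf (s , a′))
  ... | nothing = refl
  ... | just i  = inXᵏ-same s i (kindOf (s , a))

  inXAtSlot-cross : ∀ {s s′} a a′ → s ≢ s′ →
    inXAtSlot (s , a) (s′ , a′) ≡ is-just (slot (kindOf (s′ , a′))) ∧ isRight (kindOf (s , a))
  inXAtSlot-cross {s} {s′} a a′ s≢s′ with slot (kindOf (s′ , a′))
  ... | nothing = refl
  ... | just i  = inXᵏ-other i (kindOf (s , a)) s≢s′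

  same-block-odd : ∀ {s} a a′ → a ≢ a′ → coverParity cover (s , a) (s , a′) ≡ true
  same-block-odd {s} a a′ a≢a′ = begin
    coverParity cover (s , a) (s , a′)
      ≡⟨ coverParity-cover (s , a) (s , a′) ⟩
    covers leftRight (s , a) (s , a′) xor (inXAtSlot (s , a) (s , a′) xor inXAtSlot (s , a′) (s , a))
      ≡⟨ cong₂ (λ r r′ → covers leftRight (s , a) (s , a′) xor (r xor r′))
               (inXAtSlot-same s a a′) (inXAtSlot-same s a′ a) ⟩
    leftRightCovers k k′ xor (localXAtSlot k k′ xor localXAtSlot k′ k)
      ≡⟨ same-block-parity k k′ (a≢a′ ∘ kind-injective (m s)) ⟩
    true
      ∎
    where
    open ≡-Reasoning
    k = kindOf (s , a)
    k′ = kindOf (s , a′)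

  cross-block-even : ∀ {s s′} a a′ → s ≢ s′ → coverParity cover (s , a) (s′ , a′) ≡ false
  cross-block-even {s} {s′} a a′ s≢s′ = begin
    coverParity cover (s , a) (s′ , a′)
      ≡⟨ coverParity-cover (s , a) (s′ , a′) ⟩
    covers leftRight (s , a) (s′ , a′) xor
      (inXAtSlot (s , a) (s′ , a′) xor inXAtSlot (s′ , a′) (s , a))
      ≡⟨ cong₂ (λ r r′ → covers leftRight (s , a) (s′ , a′) xor (r xor r′))
               (inXAtSlot-cross a a′ s≢s′) (inXAtSlot-cross a′ a (s≢s′ ∘ sym)) ⟩
    leftRightCovers k k′ xor ((is-just (slot k′) ∧ isRight k) xor (is-just (slot k) ∧ isRight k′))
      ≡⟨ cross-block-parity k k′ ⟩
    false
      ∎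
    where
    open ≡-Reasoning
    k = kindOf (s , a)
    k′ = kindOf (s′ , a′)

  cover-isOddCover : IsOddCover (KSum j m) cover
  cover-isOddCover = parity⇒IsOddCover {C = cover} parities
    where
    parities : ∀ u v → u ≢ v → (KSum j m u v → coverParity cover u v ≡ true) ×
                                (¬ KSum j m u v → coverParity cover u v ≡ false)
    parities (s , a) (s′ , a′) u≢v with s Fin.≟ s′
    ... | yes refl = (λ _ → same-block-odd a a′ (u≢v ∘ cong (s ,_)))
                   , (λ ¬edge → contradiction (refl , u≢v) ¬edge)
    ... | no s≢s′  = (λ edge → contradiction (proj₁ edge) s≢s′)
                   , (λ _ → cross-block-even a a′ s≢s′)

sumFin-2*+1 : (m : Fin j → ℕ) → sumFin (λ t → 2 * m t + 1) ≡ j + 2 * sumFin m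
sumFin-2*+1 {zero}  m = refl
sumFin-2*+1 {suc j} m =
  trans (cong (2 * m zero + 1 +_) (sumFin-2*+1 (m ∘ suc))) (rearrange (m zero) j (sumFin (m ∘ suc)))
  where
  rearrange : ∀ a b c → (2 * a + 1) + (b + 2 * c) ≡ suc b + 2 * (a + c)
  rearrange = solve-∀

2*m≤2*n∸1⇒m<n : ∀ {m n} → 1 ≤ m → 2 * m ≤ 2 * n ∸ 1 → m < n
2*m≤2*n∸1⇒m<n {n = zero}  1≤m le = contradiction (ℕₚ.≤-trans (ℕₚ.*-monoʳ-≤ 2 1≤m) le) λ ()
2*m≤2*n∸1⇒m<n {n = suc n} _   le = ℕₚ.*-cancelˡ-< 2 _ _ (ℕₚ.≤-<-trans le (ℕₚ.n<1+n _))

theorem16 : (j : ℕ) → 1 ≤ j → (m : Fin j → ℕ) → (∀ i → 1 ≤ m i) →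
    b₂≡ (KSum j m) (sumFin m + 1)
theorem16 (suc j) _ m m≥1 = (cover , cover-isOddCover , length-cover) , lower-bound
  where
  open Construction m
  S = sumFin m
  S≥1 : 1 ≤ S
  S≥1 = ℕₚ.≤-trans (m≥1 zero) (ℕₚ.m≤m+n (m zero) _)
  lower-bound : ∀ C → IsOddCover (KSum (suc j) m) C → S + 1 ≤ length C
  lower-bound C odd = subst (_≤ length C) (ℕₚ.+-comm 1 S) (2*m≤2*n∸1⇒m<n S≥1 2S≤2k∸1)
    where
    2S≤2k∸1 : 2 * S ≤ 2 * length C ∸ 1
    2S≤2k∸1 = ℕₚ.+-cancelˡ-≤ (suc j) _ _
                (subst (_≤ suc j + (2 * length C ∸ 1)) (sumFin-2*+1 m) (cliques-oddCover-bound _ C odd))
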